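{- For integers $n,m,p$, let $\mathfrak a_{n,m,p}$ be the number of inversion sequences $\sigma\in\mathcal{I}_n(000,201)$ such that $\max(\sigma)=m$ and the value $m$ appears exactly once in $\sigma$, at position $p$. Then for all $n\geqslant 2$, $$|\mathcal{I}_n(000,201)|=\sum_{m=0}^{n-1}\sum_{p=m+1}^{n}\Big(\mathfrak a_{n,m,p}+(n-p)\,\mathfrak a_{n-1,m,p}\Big).$$
   Context: For $n\in\mathbb N$, an inversion sequence of size $n$ is a sequence $\sigma=(\sigma_1,\dots,\sigma_n)\in\mathbb N^n$ with $\sigma_i<i$ for all $i$. An integer sequence contains a pattern $\rho$ (a finite integer sequence such as $000$ or $201$) if it has a subsequence order-isomorphic to $\rho$, and avoids $\rho$ otherwise. $\mathcal{I}_n(P)$ denotes the set of inversion sequences of size $n$ avoiding every pattern in the set $P$. $\max(\sigma)$ is the largest entry of $\sigma$. -}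

module Defs where

open import Data.Nat using (ℕ; zero; suc; _+_; _∸_; _⊔_; _<ᵇ_; _≡ᵇ_)
open import Data.Bool using (Bool; true; false; _∧_; not)
open import Data.List using (List; []; _∷_; _++_; [_]; map; concatMap; upTo; length; filterᵇ; foldr)
open import Data.Bool.ListAction using (all; any)

-- All inversion sequences of size n, as lists (σ₁,…,σₙ) with σᵢ < i (1-indexed).
InvSeqs : ℕ → List (List ℕ)
InvSeqs zero    = [] ∷ []
InvSeqs (suc n) = concatMap (λ s → map (λ v → s ++ [ v ]) (upTo (suc n))) (InvSeqs n)

subseqs : ℕ → List ℕ → List (List ℕ)
subseqs zero    _        = [] ∷ []
subseqs (suc k) []       = []
subseqs (suc k) (x ∷ xs) = map (x ∷_) (subseqs k xs) ++ subseqs (suc k) xs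

cmp : ℕ → ℕ → ℕ
cmp a b with a <ᵇ b | a ≡ᵇ b
... | true  | _     = 0
... | false | true  = 1
... | false | false = 2

cmps : List ℕ → List ℕ
cmps xs = concatMap (λ a → map (λ b → cmp a b) xs) xs

eqList : List ℕ → List ℕ → Bool
eqList []       []       = true
eqList (x ∷ xs) (y ∷ ys) = (x ≡ᵇ y) ∧ eqList xs ys
eqList _        _        = false

orderIso : List ℕ → List ℕ → Bool
orderIso xs ys = (length xs ≡ᵇ length ys) ∧ eqList (cmps xs) (cmps ys)

contains : List ℕ → List ℕ → Bool
contains ρ σ = any (orderIso ρ) (subseqs (length ρ) σ)

avoidsAll : List (List ℕ) → List ℕ → Bool
avoidsAll P σ = all (λ ρ → not (contains ρ σ)) P

I : ℕ → List (List ℕ) → List (List ℕ)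
I n P = filterᵇ (avoidsAll P) (InvSeqs n)

p000 : List ℕ
p000 = 0 ∷ 0 ∷ 0 ∷ []

p201 : List ℕ
p201 = 2 ∷ 0 ∷ 1 ∷ []

maxL : List ℕ → ℕ
maxL = foldr _⊔_ 0

countL : ℕ → List ℕ → ℕ
countL m σ = length (filterᵇ (λ x → x ≡ᵇ m) σ)

-- entry at 1-indexed position p equals m
atPos : List ℕ → ℕ → ℕ → Bool
atPos []       _             _ = false
atPos (x ∷ xs) zero          _ = false
atPos (x ∷ xs) (suc zero)    m = x ≡ᵇ m
atPos (x ∷ xs) (suc (suc p)) m = atPos xs (suc p) m

𝔞 : ℕ → ℕ → ℕ → ℕ
𝔞 n m p = length (filterᵇ (λ σ → (maxL σ ≡ᵇ m) ∧ (countL m σ ≡ᵇ 1) ∧ atPos σ p m)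
                          (I n (p000 ∷ p201 ∷ [])))

range : ℕ → ℕ → List ℕ
range a b = map (a +_) (upTo (suc b ∸ a))

module Submission where

-- Let σ ∈ 𝓘ₙ(000,201) have maximum m, first occurring at position p (so m < p, σ being an inversion
-- sequence). Avoiding 000, m occurs once or twice. The σ in which it occurs once are counted by 𝔞ₙ,ₘ,ₚ.
-- If it occurs twice, deleting the second copy leaves a sequence counted by 𝔞ₙ₋₁,ₘ,ₚ, and the deleted
-- position q is any of p+1, …, n: conversely, reinserting m at position q creates no 000 (m then occurs
-- twice) and no 201, since the new m could only play the role of the 2, which the first copy of m can
-- play instead. So these σ number (n − p) 𝔞ₙ₋₁,ₘ,ₚ, and summing over (m, p) counts every σ once.

open import Defs
open import Data.Bool using (Bool; true; false; T; not; _∧_; if_then_else_)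
open import Data.Bool.Properties using (T-∧; T?)
open import Data.Empty using (⊥; ⊥-elim)
open import Data.List
  using (List; []; _∷_; _++_; [_]; map; concatMap; upTo; length; filterᵇ; replicate; take; drop
        ; cartesianProductWith; cartesianProduct; initLast; _∷ʳ′_)
open import Data.List.Properties
  using (∷-injectiveˡ; ∷-injectiveʳ; ∷ʳ-injective; ++-assoc; length-++; length-++-sucʳ; length-++-≤ˡ
        ; length-map; length-replicate; length-upTo; map-cong; map-cong-local
        ; filter-accept; filter-reject; filter-++; filter-all; filter-none; filter-some)
open import Data.List.Membership.Propositional using (_∈_; _∉_; find; lose)
open import Data.List.Membership.Propositional.Properties
  using (∈-++⁺ˡ; ∈-++⁺ʳ; ∈-++⁻; ∈-map⁺; ∈-map⁻; ∈-filter⁺; ∈-filter⁻; ∈-upTo⁺; ∈-upTo⁻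
        ; ∈-cartesianProductWith⁺; ∈-cartesianProductWith⁻; ∈-cartesianProduct⁺; ∈-cartesianProduct⁻)
open import Data.List.Membership.Propositional.Properties.WithK using (unique∧set⇒bag)
open import Data.List.Relation.Binary.BagAndSetEquality using (∼bag⇒↭)
open import Data.List.Relation.Binary.Permutation.Propositional.Properties using (↭-length)
open import Data.List.Relation.Binary.Sublist.Propositional
  using (_⊆_; []; _∷_; _∷ʳ_; minimum; ⊆-refl; ⊆-trans; lookup; from∈)
open import Data.List.Relation.Binary.Sublist.Propositional.Properties
  using (All-resp-⊆; ++⁺; filter⁺; filter-⊆; length-mono-≤)
open import Data.List.Relation.Unary.All as All using (All; []; _∷_)
open import Data.List.Relation.Unary.All.Properties using (all-filter; replicate⁺)
import Data.List.Relation.Unary.All.Properties as Allₚ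
import Data.List.Relation.Unary.AllPairs as AllPairs
open import Data.List.Relation.Unary.Any as Any using (here; there)
open import Data.List.Relation.Unary.Any.Properties using (any⁺; any⁻)
open import Data.List.Relation.Unary.Unique.Propositional using (Unique)
import Data.List.Relation.Unary.Unique.Propositional.Properties as Uniqueₚ
open import Data.Nat
  using (ℕ; zero; suc; pred; _+_; _*_; _∸_; _≤_; _<_; z≤n; s≤s; s≤s⁻¹; _≤?_; _≟_; _<ᵇ_; _≡ᵇ_)
open import Data.Nat.ListAction using (sum)
open import Data.Nat.Properties
  using (≡ᵇ⇒≡; ≡⇒≡ᵇ; <ᵇ⇒<; <⇒<ᵇ; suc-injective; 1+n≢n; +-comm; +-suc; +-cancelˡ-≡; *-comm
        ; ≤-refl; ≤-reflexive; ≤-trans; ≤-antisym; <-irrefl; <-trans; <-≤-trans; <-cmp; <⇒≤; <⇒≱; ≰⇒>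
        ; ≤∧≢⇒<; n≤1+n; n<1+n; n≮0; m≤m+n; m≤n+m; m+n≡0⇒m≡0; m+n≡0⇒n≡0
        ; m+[n∸m]≡n; ∸-monoˡ-<; m≤o∸n⇒m+n≤o; m∸n≢0⇒n<m
        ; m≤m⊔n; m≤n⊔m; ⊔-lub; ⊔-sel; ⊔-identityʳ; +-commutativeSemigroup)
open import Algebra.Properties.CommutativeSemigroup +-commutativeSemigroup using (interchange; x∙yz≈y∙xz)
open import Data.Product using (∃₂; ∃-syntax; _×_; _,_; proj₁; proj₂)
open import Data.Sum using (_⊎_; inj₁; inj₂)
open import Data.Unit using (⊤; tt)
open import Function using (_∘_; _⇔_; Equivalence; mk⇔)
open import Relation.Binary.Definitions using (tri<; tri≈; tri>)
open import Relation.Binary.PropositionalEquality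
  using (_≡_; _≢_; refl; sym; trans; cong; cong₂; subst; module ≡-Reasoning)
open import Relation.Nullary using (¬_; Dec; yes; no)

open Equivalence using (to; from)

cmp-< : ∀ {a b} → a < b → cmp a b ≡ 0
cmp-< {a} {b} a<b with a <ᵇ b in lt
... | true  = refl
... | false = ⊥-elim (subst T lt (<⇒<ᵇ a<b))

cmp-≡ : ∀ a → cmp a a ≡ 1
cmp-≡ a with a <ᵇ a in lt | a ≡ᵇ a in eq
... | true  | _     = ⊥-elim (<-irrefl refl (<ᵇ⇒< a a (subst T (sym lt) tt)))
... | false | true  = refl
... | false | false = ⊥-elim (subst T eq (≡⇒≡ᵇ a a refl))

cmp-> : ∀ {a b} → b < a → cmp a b ≡ 2
cmp-> {a} {b} b<a with a <ᵇ b in lt | a ≡ᵇ b in eq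
... | true  | _     = ⊥-elim (<-irrefl refl (<-trans b<a (<ᵇ⇒< a b (subst T (sym lt) tt))))
... | false | true  = ⊥-elim (<-irrefl (sym (≡ᵇ⇒≡ a b (subst T (sym eq) tt))) b<a)
... | false | false = refl

cmp≡0⇒< : ∀ a b → cmp a b ≡ 0 → a < b
cmp≡0⇒< a b c with <-cmp a b
... | tri< a<b _ _ = a<b
cmp≡0⇒< a a c | tri≈ _ refl _ with () ← trans (sym (cmp-≡ a)) c
cmp≡0⇒< a b c | tri> _ _ b<a with () ← trans (sym (cmp-> b<a)) c

cmp≡1⇒≡ : ∀ a b → cmp a b ≡ 1 → a ≡ b
cmp≡1⇒≡ a b c with <-cmp a b
... | tri≈ _ a≡b _ = a≡b
cmp≡1⇒≡ a b c | tri< a<b _ _ with () ← trans (sym (cmp-< a<b)) c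
cmp≡1⇒≡ a b c | tri> _ _ b<a with () ← trans (sym (cmp-> b<a)) c

eqList⇒≡ : ∀ xs ys → T (eqList xs ys) → xs ≡ ys
eqList⇒≡ []       []       _ = refl
eqList⇒≡ (x ∷ xs) (y ∷ ys) t with t₁ , t₂ ← T-∧ .to t =
  cong₂ _∷_ (≡ᵇ⇒≡ x y t₁) (eqList⇒≡ xs ys t₂)

eqList-refl : ∀ xs → T (eqList xs xs)
eqList-refl []       = tt
eqList-refl (x ∷ xs) = T-∧ .from (≡⇒≡ᵇ x x refl , eqList-refl xs)

orderIso⁻ : ∀ ρ s → T (orderIso ρ s) → cmps ρ ≡ cmps s
orderIso⁻ ρ s t = eqList⇒≡ (cmps ρ) (cmps s) (proj₂ (T-∧ .to t))

orderIso⁺ : ∀ ρ s → length ρ ≡ length s → cmps s ≡ cmps ρ → T (orderIso ρ s)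
orderIso⁺ ρ s l c =
  T-∧ .from (≡⇒≡ᵇ _ _ l , subst (T ∘ eqList (cmps ρ)) (sym c) (eqList-refl (cmps ρ)))

orderIso-000⁻ : ∀ {a b c} → T (orderIso p000 (a ∷ b ∷ c ∷ [])) → a ≡ b × b ≡ c
orderIso-000⁻ {a} {b} {c} t = cmp≡1⇒≡ a b (sym (∷-injectiveˡ (cong (drop 1) e)))
                            , cmp≡1⇒≡ b c (sym (∷-injectiveˡ (cong (drop 5) e)))
  where e = orderIso⁻ p000 (a ∷ b ∷ c ∷ []) t

orderIso-000⁺ : ∀ a → T (orderIso p000 (a ∷ a ∷ a ∷ []))
orderIso-000⁺ a = orderIso⁺ p000 (a ∷ a ∷ a ∷ []) refl eq
  where eq : cmps (a ∷ a ∷ a ∷ []) ≡ cmps p000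
        eq rewrite cmp-≡ a = refl

orderIso-201⁻ : ∀ {a b c} → T (orderIso p201 (a ∷ b ∷ c ∷ [])) → b < c × c < a
orderIso-201⁻ {a} {b} {c} t = cmp≡0⇒< b c (sym (∷-injectiveˡ (cong (drop 5) e)))
                            , cmp≡0⇒< c a (sym (∷-injectiveˡ (cong (drop 6) e)))
  where e = orderIso⁻ p201 (a ∷ b ∷ c ∷ []) t

orderIso-201⁺ : ∀ {a b c} → b < c → c < a → T (orderIso p201 (a ∷ b ∷ c ∷ []))
orderIso-201⁺ {a} {b} {c} b<c c<a = orderIso⁺ p201 (a ∷ b ∷ c ∷ []) refl eq
  where eq : cmps (a ∷ b ∷ c ∷ []) ≡ cmps p201
        eq rewrite cmp-≡ a | cmp-≡ b | cmp-≡ c | cmp-> (<-trans b<c c<a) | cmp-> c<a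
                 | cmp-< b<c | cmp-< c<a | cmp-< (<-trans b<c c<a) | cmp-> b<c = refl

∈-subseqs⁻ : ∀ k σ {s} → s ∈ subseqs k σ → length s ≡ k × s ⊆ σ
∈-subseqs⁻ zero    σ        (here refl) = refl , minimum σ
∈-subseqs⁻ (suc k) (x ∷ σ) s∈ with ∈-++⁻ (map (x ∷_) (subseqs k σ)) s∈
... | inj₁ s∈′ with s′ , s′∈ , refl ← ∈-map⁻ (x ∷_) s∈′
               with l , s′⊆ ← ∈-subseqs⁻ k σ s′∈ = cong suc l , refl ∷ s′⊆
... | inj₂ s∈′ with l , s⊆ ← ∈-subseqs⁻ (suc k) σ s∈′ = l , x ∷ʳ s⊆

∈-subseqs⁺ : ∀ {s σ} → s ⊆ σ → s ∈ subseqs (length s) σ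
∈-subseqs⁺ []                = here refl
∈-subseqs⁺ {[]}    (y ∷ʳ _)  = here refl
∈-subseqs⁺ {_ ∷ s} (y ∷ʳ s⊆) = ∈-++⁺ʳ (map (y ∷_) (subseqs (length s) _)) (∈-subseqs⁺ s⊆)
∈-subseqs⁺         (refl ∷ s⊆) = ∈-++⁺ˡ (∈-map⁺ (_ ∷_) (∈-subseqs⁺ s⊆))

contains⁻ : ∀ ρ σ → T (contains ρ σ) → ∃[ s ] s ⊆ σ × length s ≡ length ρ × T (orderIso ρ s)
contains⁻ ρ σ c with s , s∈ , iso ← find (any⁻ (orderIso ρ) (subseqs (length ρ) σ) c)
                with l , s⊆ ← ∈-subseqs⁻ (length ρ) σ s∈ = s , s⊆ , l , iso

contains⁺ : ∀ ρ {s σ} → s ⊆ σ → length s ≡ length ρ → T (orderIso ρ s) → T (contains ρ σ)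
contains⁺ ρ {s} {σ} s⊆ l iso =
  any⁺ (orderIso ρ) (lose (subst (λ k → s ∈ subseqs k σ) l (∈-subseqs⁺ s⊆)) iso)

is? : ∀ a x → Dec (T (x ≡ᵇ a))
is? a x = T? (x ≡ᵇ a)

countL-here : ∀ a xs → countL a (a ∷ xs) ≡ suc (countL a xs)
countL-here a xs = cong length (filter-accept (is? a) {x = a} {xs = xs} (≡⇒≡ᵇ a a refl))

countL-there : ∀ {a x} xs → x ≢ a → countL a (x ∷ xs) ≡ countL a xs
countL-there {a} {x} xs x≢a = cong length (filter-reject (is? a) {x = x} {xs = xs} (x≢a ∘ ≡ᵇ⇒≡ x a))

countL-++ : ∀ a xs ys → countL a (xs ++ ys) ≡ countL a xs + countL a ys
countL-++ a xs ys = trans (cong length (filter-++ (is? a) xs ys)) (length-++ (filterᵇ (_≡ᵇ a) xs))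

countL-insert : ∀ a xs y ys → countL a (xs ++ y ∷ ys) ≡ countL a [ y ] + countL a (xs ++ ys)
countL-insert a xs y ys = begin
  countL a (xs ++ y ∷ ys)                      ≡⟨ countL-++ a xs (y ∷ ys) ⟩
  countL a xs + countL a ([ y ] ++ ys)         ≡⟨ cong (countL a xs +_) (countL-++ a [ y ] ys) ⟩
  countL a xs + (countL a [ y ] + countL a ys) ≡⟨ x∙yz≈y∙xz (countL a xs) (countL a [ y ]) (countL a ys) ⟩
  countL a [ y ] + (countL a xs + countL a ys) ≡⟨ cong (countL a [ y ] +_) (countL-++ a xs ys) ⟨
  countL a [ y ] + countL a (xs ++ ys)         ∎
  where open ≡-Reasoning

countL-∉ : ∀ {a xs} → a ∉ xs → countL a xs ≡ 0
countL-∉ {a} a∉ =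
  cong length (filter-none (is? a) (All.tabulate λ x∈ t → a∉ (subst (_∈ _) (≡ᵇ⇒≡ _ a t) x∈)))

∈⇒1≤countL : ∀ {a xs} → a ∈ xs → 1 ≤ countL a xs
∈⇒1≤countL {a} a∈ = filter-some (is? a) (Any.map (λ { refl → ≡⇒≡ᵇ a a refl }) a∈)

countL≡0⇒∉ : ∀ {a xs} → countL a xs ≡ 0 → a ∉ xs
countL≡0⇒∉ c a∈ with () ← subst (1 ≤_) c (∈⇒1≤countL a∈)

countL-++-∷ : ∀ m u r → countL m (u ++ m ∷ r) ≡ suc (countL m u + countL m r)
countL-++-∷ m u r =
  trans (countL-++ m u (m ∷ r)) (trans (cong (countL m u +_) (countL-here m r)) (+-suc _ _))

countL-once : ∀ {m} u r → m ∉ u → m ∉ r → countL m (u ++ m ∷ r) ≡ 1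
countL-once {m} u r m∉u m∉r rewrite countL-++-∷ m u r | countL-∉ m∉u | countL-∉ m∉r = refl

∉-++ : ∀ {A : Set} {m : A} {v w} → m ∉ v → m ∉ w → m ∉ v ++ w
∉-++ {v = v} m∉v m∉w m∈ with ∈-++⁻ v m∈
... | inj₁ m∈v = m∉v m∈v
... | inj₂ m∈w = m∉w m∈w

countL-mono : ∀ a {s σ} → s ⊆ σ → countL a s ≤ countL a σ
countL-mono a s⊆ = length-mono-≤ (filter⁺ (is? a) (is? a) (λ { refl t → t }) s⊆)

countL-replicate : ∀ k a → countL a (replicate k a) ≡ k
countL-replicate k a =
  trans (cong length (filter-all (is? a) (replicate⁺ k (≡⇒≡ᵇ a a refl)))) (length-replicate k)

countL-split : ∀ a σ {c} → countL a σ ≡ suc c →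
               ∃₂ λ u r → σ ≡ u ++ a ∷ r × a ∉ u × countL a r ≡ c
countL-split a (x ∷ σ) eq with x ≟ a
... | yes refl = [] , σ , refl , (λ ()) , suc-injective (trans (sym (countL-here a σ)) eq)
... | no x≢a with u , r , refl , a∉u , c ← countL-split a σ (trans (sym (countL-there σ x≢a)) eq) =
  x ∷ u , r , refl , (λ { (here refl) → x≢a refl ; (there a∈u) → a∉u a∈u }) , c

replicate-⊆ : ∀ {A : Set} {a : A} {xs} k → All (_≡ a) xs → k ≤ length xs → replicate k a ⊆ xs
replicate-⊆ {xs = xs} zero _           _         = minimum xs
replicate-⊆           (suc k) (refl ∷ as) (s≤s k≤) = refl ∷ replicate-⊆ k as k≤

countL⇒replicate-⊆ : ∀ {a σ} k → k ≤ countL a σ → replicate k a ⊆ σ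
countL⇒replicate-⊆ {a} {σ} k k≤ =
  ⊆-trans (replicate-⊆ k (All.map (≡ᵇ⇒≡ _ a) (all-filter (is? a) σ)) k≤) (filter-⊆ (is? a) σ)

-- Avoiding 000 and 201

Avoids000 : List ℕ → Set
Avoids000 σ = ∀ a → countL a σ ≤ 2

Avoids201 : List ℕ → Set
Avoids201 σ = ∀ {a b c} → a ∷ b ∷ c ∷ [] ⊆ σ → b < c → c < a → ⊥

Avoids : List ℕ → Set
Avoids σ = Avoids000 σ × Avoids201 σ

patterns : List (List ℕ)
patterns = p000 ∷ p201 ∷ []

avoids000⁺ : ∀ {σ} → Avoids000 σ → ¬ T (contains p000 σ)
avoids000⁺ {σ} av c with contains⁻ p000 σ c
... | a ∷ b ∷ c ∷ [] , s⊆ , refl , iso with refl , refl ← orderIso-000⁻ {a} {b} {c} iso =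
  <⇒≱ (s≤s (av a)) (subst (_≤ countL a σ) (countL-replicate 3 a) (countL-mono a s⊆))

avoids000⁻ : ∀ {σ} → ¬ T (contains p000 σ) → Avoids000 σ
avoids000⁻ {σ} ¬c a with countL a σ ≤? 2
... | yes ≤2 = ≤2
... | no  ≰2 =
  ⊥-elim (¬c (contains⁺ p000 (countL⇒replicate-⊆ {a} {σ} 3 (≰⇒> ≰2)) refl (orderIso-000⁺ a)))

avoids201⁺ : ∀ {σ} → Avoids201 σ → ¬ T (contains p201 σ)
avoids201⁺ {σ} av c with contains⁻ p201 σ c
... | a ∷ b ∷ c ∷ [] , s⊆ , refl , iso with b<c , c<a ← orderIso-201⁻ {a} {b} {c} iso = av s⊆ b<c c<a

avoids201⁻ : ∀ {σ} → ¬ T (contains p201 σ) → Avoids201 σ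
avoids201⁻ {σ} ¬c {a} {b} {c} s⊆ b<c c<a =
  ¬c (contains⁺ p201 {a ∷ b ∷ c ∷ []} {σ} s⊆ refl (orderIso-201⁺ b<c c<a))

T-not⁻ : ∀ {b} → T (not b) → ¬ T b
T-not⁻ {false} _ ()

T-not⁺ : ∀ {b} → ¬ T b → T (not b)
T-not⁺ {true}  ¬t = ¬t tt
T-not⁺ {false} _  = tt

avoidsAll⁻ : ∀ {σ} → T (avoidsAll patterns σ) → Avoids σ
avoidsAll⁻ {σ} t with t₀₀₀ , t′ ← T-∧ {not (contains p000 σ)} .to t
                 with t₂₀₁ , _ ← T-∧ {not (contains p201 σ)} .to t′ =
  avoids000⁻ {σ} (T-not⁻ t₀₀₀) , avoids201⁻ {σ} (T-not⁻ t₂₀₁)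

avoidsAll⁺ : ∀ {σ} → Avoids σ → T (avoidsAll patterns σ)
avoidsAll⁺ {σ} (av₀₀₀ , av₂₀₁) =
  T-∧ .from (T-not⁺ (avoids000⁺ {σ} av₀₀₀) , T-∧ .from (T-not⁺ (avoids201⁺ {σ} av₂₀₁) , tt))

Avoids-⊆ : ∀ {τ σ} → τ ⊆ σ → Avoids σ → Avoids τ
Avoids-⊆ τ⊆ (av₀₀₀ , av₂₀₁) =
  (λ a → ≤-trans (countL-mono a τ⊆) (av₀₀₀ a)) , (λ s⊆ → av₂₀₁ (⊆-trans s⊆ τ⊆))

⊆-split : ∀ {A : Set} {s : List A} xs y {ys} → s ⊆ xs ++ y ∷ ys →
          s ⊆ xs ++ ys ⊎ ∃₂ λ s₁ s₂ → s ≡ s₁ ++ y ∷ s₂ × s₁ ⊆ xs × s₂ ⊆ ys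
⊆-split []       y (.y ∷ʳ s⊆)  = inj₁ s⊆
⊆-split []       y (refl ∷ s⊆) = inj₂ ([] , _ , refl , [] , s⊆)
⊆-split (x ∷ xs) y (.x ∷ʳ s⊆) with ⊆-split xs y s⊆
... | inj₁ s⊆′                          = inj₁ (x ∷ʳ s⊆′)
... | inj₂ (s₁ , s₂ , eq , s₁⊆ , s₂⊆)   = inj₂ (s₁ , s₂ , eq , x ∷ʳ s₁⊆ , s₂⊆)
⊆-split (x ∷ xs) y (refl ∷ s⊆) with ⊆-split xs y s⊆
... | inj₁ s⊆′                          = inj₁ (refl ∷ s⊆′)
... | inj₂ (s₁ , s₂ , refl , s₁⊆ , s₂⊆) = inj₂ (x ∷ s₁ , s₂ , refl , refl ∷ s₁⊆ , s₂⊆)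

⊆-delete : ∀ {A : Set} xs {y : A} {ys} → xs ++ ys ⊆ xs ++ y ∷ ys
⊆-delete xs {y} = ++⁺ ⊆-refl (y ∷ʳ ⊆-refl)

-- The inserted y can only serve as the head x, and the copy of y in xs can take its place.
⊆-dropDuplicate : ∀ {A : Set} {x y : A} {zs} xs {ys} → y ∈ xs → y ∉ zs →
                  x ∷ zs ⊆ xs ++ y ∷ ys → x ∷ zs ⊆ xs ++ ys
⊆-dropDuplicate xs y∈xs y∉zs s⊆ with ⊆-split xs _ s⊆
... | inj₁ s⊆′                            = s⊆′
... | inj₂ ([]     , s₂ , refl , _ , s₂⊆) = ++⁺ (from∈ y∈xs) s₂⊆
... | inj₂ (_ ∷ s₁ , s₂ , refl , _ , _)   = ⊥-elim (y∉zs (∈-++⁺ʳ s₁ (here refl)))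

All-insert : ∀ {A : Set} {P : A → Set} xs {y ys} → All P (xs ++ ys) → P y → All P (xs ++ y ∷ ys)
All-insert xs all py = Allₚ.++⁺ (Allₚ.++⁻ˡ xs all) (py ∷ Allₚ.++⁻ʳ xs all)

Avoids000-insert : ∀ {m} xs {w} → countL m (xs ++ w) ≤ 1 → Avoids000 (xs ++ w) → Avoids000 (xs ++ m ∷ w)
Avoids000-insert {m} xs {w} c≤1 av a rewrite countL-insert a xs m w with m ≟ a
... | yes refl rewrite countL-here a [] = s≤s c≤1
... | no  m≢a  rewrite countL-there {a} [] m≢a = av a

Avoids201-insert : ∀ {m} xs {w} → m ∈ xs → All (_≤ m) (xs ++ w) →
                   Avoids201 (xs ++ w) → Avoids201 (xs ++ m ∷ w)
Avoids201-insert {m} xs m∈xs bounded av s⊆ b<c c<a =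
  av (⊆-dropDuplicate xs m∈xs m∉bc s⊆) b<c c<a
  where
  a≤m = All.lookup (All-insert xs bounded ≤-refl) (lookup s⊆ (here refl))
  m∉bc : m ∉ _ ∷ _ ∷ []
  m∉bc (here refl)         = <⇒≱ (<-trans b<c c<a) a≤m
  m∉bc (there (here refl)) = <⇒≱ c<a a≤m

Avoids-insert : ∀ {m} xs {w} → m ∈ xs → countL m (xs ++ w) ≤ 1 → All (_≤ m) (xs ++ w) →
                Avoids (xs ++ w) → Avoids (xs ++ m ∷ w)
Avoids-insert xs m∈xs c≤1 bounded (av₀₀₀ , av₂₀₁) =
  Avoids000-insert xs c≤1 av₀₀₀ , Avoids201-insert xs m∈xs bounded av₂₀₁

-- Inversion sequences

-- The i-th entry (i = 0, 1, …) is below k + i; InvFrom 1 is the inversion-sequence condition.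
InvFrom : ℕ → List ℕ → Set
InvFrom k []       = ⊤
InvFrom k (x ∷ xs) = x < k × InvFrom (suc k) xs

InvFrom-++⁻ : ∀ k xs {ys} → InvFrom k (xs ++ ys) → InvFrom k xs × InvFrom (length xs + k) ys
InvFrom-++⁻ k []       inv        = tt , inv
InvFrom-++⁻ k (x ∷ xs) {ys} (x< , inv) with invxs , invys ← InvFrom-++⁻ (suc k) xs inv =
  (x< , invxs) , subst (λ j → InvFrom j ys) (+-suc (length xs) k) invys

InvFrom-++⁺ : ∀ k xs {ys} → InvFrom k xs → InvFrom (length xs + k) ys → InvFrom k (xs ++ ys)
InvFrom-++⁺ k []       _            invys = invys
InvFrom-++⁺ k (x ∷ xs) {ys} (x< , invxs) invys =
  x< , InvFrom-++⁺ (suc k) xs invxs (subst (λ j → InvFrom j ys) (sym (+-suc (length xs) k)) invys)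

InvFrom-mono : ∀ {j k} xs → j ≤ k → InvFrom j xs → InvFrom k xs
InvFrom-mono []       _   _          = tt
InvFrom-mono (x ∷ xs) j≤k (x< , inv) = <-≤-trans x< j≤k , InvFrom-mono xs (s≤s j≤k) inv

InvFrom-bounded : ∀ {k xs} → All (_< k) xs → InvFrom k xs
InvFrom-bounded []          = tt
InvFrom-bounded (x< ∷ all<) = x< , InvFrom-bounded (All.map (λ y< → <-trans y< (n<1+n _)) all<)

InvFrom-∈ : ∀ k xs {x} → InvFrom k xs → x ∈ xs → x < length xs + k
InvFrom-∈ k (y ∷ xs)     (y< , _)  (here refl) = <-≤-trans y< (m≤n+m k (length (y ∷ xs)))
InvFrom-∈ k (y ∷ xs) {x} (_ , inv) (there x∈)  =
  subst (x <_) (+-suc (length xs) k) (InvFrom-∈ (suc k) xs inv x∈)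

InvFrom-insert : ∀ k xs {y ys} → InvFrom k (xs ++ ys) → y < length xs + k → InvFrom k (xs ++ y ∷ ys)
InvFrom-insert k xs inv y< with invxs , invys ← InvFrom-++⁻ k xs inv =
  InvFrom-++⁺ k xs invxs (y< , InvFrom-mono _ (n≤1+n _) invys)

InvFrom-delete : ∀ k xs {y ys} → InvFrom k (xs ++ y ∷ ys) → All (_< y) ys → InvFrom k (xs ++ ys)
InvFrom-delete k xs inv ys<y with invxs , (y< , _) ← InvFrom-++⁻ k xs inv =
  InvFrom-++⁺ k xs invxs (InvFrom-bounded (All.map (λ z< → <-trans z< y<) ys<y))

concatMap≡cartesianProductWith : ∀ {A B C : Set} (f : A → B → C) xs ys →
  concatMap (λ x → map (f x) ys) xs ≡ cartesianProductWith f xs ys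
concatMap≡cartesianProductWith f []       ys = refl
concatMap≡cartesianProductWith f (x ∷ xs) ys = cong (map (f x) ys ++_) (concatMap≡cartesianProductWith f xs ys)

InvSeqs-suc : ∀ n → InvSeqs (suc n) ≡ cartesianProductWith (λ s v → s ++ [ v ]) (InvSeqs n) (upTo (suc n))
InvSeqs-suc n = concatMap≡cartesianProductWith (λ s v → s ++ [ v ]) (InvSeqs n) (upTo (suc n))

∈-InvSeqs⁻ : ∀ n {σ} → σ ∈ InvSeqs n → length σ ≡ n × InvFrom 1 σ
∈-InvSeqs⁻ zero    (here refl) = refl , tt
∈-InvSeqs⁻ (suc n) σ∈
  with s , v , s∈ , v∈ , refl ← ∈-cartesianProductWith⁻ (λ s v → s ++ [ v ]) (InvSeqs n) (upTo (suc n))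
                                                        (subst (_ ∈_) (InvSeqs-suc n) σ∈)
  with l , inv ← ∈-InvSeqs⁻ n s∈ =
  trans (length-++ s) (trans (+-comm (length s) 1) (cong suc l)) ,
  InvFrom-++⁺ 1 s inv (subst (v <_) (trans (cong suc (sym l)) (+-comm 1 (length s))) (∈-upTo⁻ v∈) , tt)

∈-InvSeqs⁺ : ∀ n {σ} → length σ ≡ n → InvFrom 1 σ → σ ∈ InvSeqs n
∈-InvSeqs⁺ zero    {[]}    _ _   = here refl
∈-InvSeqs⁺ (suc n) {σ}     l inv with initLast σ
... | s ∷ʳ′ v with invs , (v< , _) ← InvFrom-++⁻ 1 s inv =
  subst (_ ∈_) (sym (InvSeqs-suc n))
        (∈-cartesianProductWith⁺ (λ s v → s ++ [ v ]) (∈-InvSeqs⁺ n ls invs)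
                                 (∈-upTo⁺ (subst (v <_) l+1≡ v<)))
  where
  l+1≡ : length s + 1 ≡ suc n
  l+1≡ = trans (sym (length-++ s)) l
  ls : length s ≡ n
  ls = suc-injective (trans (+-comm 1 (length s)) l+1≡)

InvSeqs-unique : ∀ n → Unique (InvSeqs n)
InvSeqs-unique zero    = [] AllPairs.∷ AllPairs.[]
InvSeqs-unique (suc n) = subst Unique (sym (InvSeqs-suc n))
  (Uniqueₚ.cartesianProductWith⁺ (λ s v → s ++ [ v ]) (λ {s} {s′} e → ∷ʳ-injective s s′ e)
                                 (InvSeqs-unique n) (Uniqueₚ.upTo⁺ (suc n)))

record In𝓘 (n : ℕ) (σ : List ℕ) : Set where
  field
    size    : length σ ≡ n
    entries : InvFrom 1 σ
    avoids  : Avoids σ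

∈-𝓘⁻ : ∀ n {σ} → σ ∈ I n patterns → In𝓘 n σ
∈-𝓘⁻ n σ∈ with σ∈′ , t ← ∈-filter⁻ (T? ∘ avoidsAll patterns) σ∈
          with l , inv ← ∈-InvSeqs⁻ n σ∈′ = record { size = l ; entries = inv ; avoids = avoidsAll⁻ t }

∈-𝓘⁺ : ∀ n {σ} → In𝓘 n σ → σ ∈ I n patterns
∈-𝓘⁺ n σ∈ = ∈-filter⁺ (T? ∘ avoidsAll patterns) (∈-InvSeqs⁺ n size entries) (avoidsAll⁺ avoids)
  where open In𝓘 σ∈

𝓘-unique : ∀ n → Unique (I n patterns)
𝓘-unique n = Uniqueₚ.filter⁺ (T? ∘ avoidsAll patterns) (InvSeqs-unique n)

In𝓘-insert : ∀ {n m} xs {w} → In𝓘 n (xs ++ w) → m ∈ xs → countL m (xs ++ w) ≤ 1 → All (_≤ m) (xs ++ w) →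
             In𝓘 (suc n) (xs ++ m ∷ w)
In𝓘-insert {m = m} xs {w} τ∈ m∈xs c≤1 bounded = record
  { size    = trans (length-++-sucʳ xs m w) (cong suc size)
  ; entries = InvFrom-insert 1 xs entries (InvFrom-∈ 1 xs (proj₁ (InvFrom-++⁻ 1 xs entries)) m∈xs)
  ; avoids  = Avoids-insert xs m∈xs c≤1 bounded avoids }
  where open In𝓘 τ∈

In𝓘-delete : ∀ {n m} xs {w} → In𝓘 (suc n) (xs ++ m ∷ w) → All (_< m) w → In𝓘 n (xs ++ w)
In𝓘-delete {m = m} xs {w} σ∈ w<m = record
  { size    = suc-injective (trans (sym (length-++-sucʳ xs m w)) size)
  ; entries = InvFrom-delete 1 xs entries w<m
  ; avoids  = Avoids-⊆ (⊆-delete xs) avoids }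
  where open In𝓘 σ∈

maxL-upper : ∀ xs → All (_≤ maxL xs) xs
maxL-upper []       = []
maxL-upper (x ∷ xs) = m≤m⊔n x _ ∷ All.map (λ y≤ → ≤-trans y≤ (m≤n⊔m x _)) (maxL-upper xs)

maxL-least : ∀ {m} xs → All (_≤ m) xs → maxL xs ≤ m
maxL-least []       []          = z≤n
maxL-least (x ∷ xs) (x≤ ∷ xs≤) = ⊔-lub x≤ (maxL-least xs xs≤)

maxL-≡ : ∀ {m xs} → m ∈ xs → All (_≤ m) xs → maxL xs ≡ m
maxL-≡ m∈ xs≤ = ≤-antisym (maxL-least _ xs≤) (All.lookup (maxL-upper _) m∈)

maxL-∈ : ∀ xs → 0 < length xs → maxL xs ∈ xs
maxL-∈ (x ∷ [])     _ = here (⊔-identityʳ x)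
maxL-∈ (x ∷ y ∷ xs) _ with maxL-∈ (y ∷ xs) (s≤s z≤n) | ⊔-sel x (maxL (y ∷ xs))
... | _  | inj₁ eq = here eq
... | ih | inj₂ eq = there (subst (_∈ y ∷ xs) (sym eq) ih)

-- 1-indexed, like atPos.
firstPos : ℕ → List ℕ → ℕ
firstPos m []       = 0
firstPos m (x ∷ xs) with x ≟ m
... | yes _ = 1
... | no  _ = suc (firstPos m xs)

firstPos-++ : ∀ {m} u r → m ∉ u → firstPos m (u ++ m ∷ r) ≡ suc (length u)
firstPos-++ {m} []      r _ with m ≟ m
... | yes _   = refl
... | no  m≢m = ⊥-elim (m≢m refl)
firstPos-++ {m} (x ∷ u) r m∉ with x ≟ m
... | yes refl = ⊥-elim (m∉ (here refl))
... | no  _    = cong suc (firstPos-++ u r (m∉ ∘ there))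

atPos-++ : ∀ {m} u r → T (atPos (u ++ m ∷ r) (suc (length u)) m)
atPos-++ {m} []      r = ≡⇒≡ᵇ m m refl
atPos-++     (x ∷ u) r = atPos-++ u r

atPos⁻ : ∀ σ p {m} → T (atPos σ p m) → ∃₂ λ u r → σ ≡ u ++ m ∷ r × suc (length u) ≡ p
atPos⁻ (x ∷ σ) (suc zero)    t with refl ← ≡ᵇ⇒≡ x _ t                   = [] , σ , refl , refl
atPos⁻ (x ∷ σ) (suc (suc p)) t with u , r , refl , refl ← atPos⁻ σ (suc p) t = x ∷ u , r , refl , refl

T-∧₃⁻ : ∀ {a b c} → T (a ∧ b ∧ c) → T a × T b × T c
T-∧₃⁻ {true} {true} t = tt , tt , t

T-∧₃⁺ : ∀ {a b c} → T a → T b → T c → T (a ∧ b ∧ c)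
T-∧₃⁺ {true} {true} _ _ t = t

-- 𝔞 n m p is by definition the length of filterᵇ (uniqueMaxAt m p) (I n patterns).
uniqueMaxAt : ℕ → ℕ → List ℕ → Bool
uniqueMaxAt m p σ = (maxL σ ≡ᵇ m) ∧ (countL m σ ≡ᵇ 1) ∧ atPos σ p m

doubleMaxAt : ℕ → ℕ → List ℕ → Bool
doubleMaxAt m p σ = (maxL σ ≡ᵇ m) ∧ (countL m σ ≡ᵇ 2) ∧ (firstPos m σ ≡ᵇ p)

record UniqueMaxAt (m p : ℕ) (σ : List ℕ) : Set where
  field
    u r      : List ℕ
    split    : σ ≡ u ++ m ∷ r
    position : suc (length u) ≡ p
    m∉u      : m ∉ u
    m∉r      : m ∉ r
    bounded  : All (_≤ m) σ

record DoubleMaxAt (m p : ℕ) (σ : List ℕ) : Set where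
  field
    u v w    : List ℕ
    split    : σ ≡ u ++ m ∷ v ++ m ∷ w
    position : suc (length u) ≡ p
    m∉u      : m ∉ u
    m∉v      : m ∉ v
    m∉w      : m ∉ w
    bounded  : All (_≤ m) σ

uniqueMaxAt⁻ : ∀ {m p} σ → T (uniqueMaxAt m p σ) → UniqueMaxAt m p σ
uniqueMaxAt⁻ {m} {p} σ t with tmax , tcount , tat ← T-∧₃⁻ {maxL σ ≡ᵇ m} {countL m σ ≡ᵇ 1} t
                         with u , r , refl , pos ← atPos⁻ σ p tat = record
  { u = u ; r = r ; split = refl ; position = pos
  ; m∉u = countL≡0⇒∉ (m+n≡0⇒m≡0 _ counts≡0)
  ; m∉r = countL≡0⇒∉ (m+n≡0⇒n≡0 (countL m u) counts≡0)
  ; bounded = subst (λ k → All (_≤ k) σ) (≡ᵇ⇒≡ _ m tmax) (maxL-upper σ) }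
  where
  counts≡0 : countL m u + countL m r ≡ 0
  counts≡0 = suc-injective (trans (sym (countL-++-∷ m u r)) (≡ᵇ⇒≡ _ 1 tcount))

uniqueMaxAt⁺ : ∀ {m p σ} → UniqueMaxAt m p σ → T (uniqueMaxAt m p σ)
uniqueMaxAt⁺ {m} {p} {σ} um = T-∧₃⁺
  (≡⇒≡ᵇ _ m (maxL-≡ (subst (m ∈_) (sym split) (∈-++⁺ʳ u (here refl))) bounded))
  (≡⇒≡ᵇ _ 1 (trans (cong (countL m) split) (countL-once u r m∉u m∉r)))
  (subst (λ σ → T (atPos σ p m)) (sym split)
         (subst (λ p → T (atPos (u ++ m ∷ r) p m)) position (atPos-++ u r)))
  where open UniqueMaxAt um

doubleMaxAt⁻ : ∀ {m p} σ → T (doubleMaxAt m p σ) → DoubleMaxAt m p σ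
doubleMaxAt⁻ {m} {p} σ t with tmax , tcount , tpos ← T-∧₃⁻ {maxL σ ≡ᵇ m} {countL m σ ≡ᵇ 2} t
                         with u , r , refl , m∉u , c₁ ← countL-split m σ (≡ᵇ⇒≡ _ 2 tcount)
                         with v , w , refl , m∉v , c₀ ← countL-split m r c₁ = record
  { u = u ; v = v ; w = w ; split = refl
  ; position = trans (sym (firstPos-++ u _ m∉u)) (≡ᵇ⇒≡ _ p tpos)
  ; m∉u = m∉u ; m∉v = m∉v ; m∉w = countL≡0⇒∉ c₀
  ; bounded = subst (λ k → All (_≤ k) σ) (≡ᵇ⇒≡ _ m tmax) (maxL-upper σ) }

doubleMaxAt⁺ : ∀ {m p σ} → DoubleMaxAt m p σ → T (doubleMaxAt m p σ)
doubleMaxAt⁺ {m} {p} {σ} dm = T-∧₃⁺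
  (≡⇒≡ᵇ _ m (maxL-≡ (subst (m ∈_) (sym split) (∈-++⁺ʳ u (here refl))) bounded))
  (≡⇒≡ᵇ _ 2 (trans (cong (countL m) split) count≡2))
  (≡⇒≡ᵇ _ p (trans (cong (firstPos m) split) (trans (firstPos-++ u _ m∉u) position)))
  where
  open DoubleMaxAt dm
  count≡2 : countL m (u ++ m ∷ v ++ m ∷ w) ≡ 2
  count≡2 rewrite countL-++-∷ m u (v ++ m ∷ w) | countL-∉ m∉u | countL-once v w m∉v m∉w = refl

ind : Bool → ℕ
ind b = if b then 1 else 0

ind-T : ∀ {b} → T b → ind b ≡ 1
ind-T {true} _ = refl

ind-¬T : ∀ {b} → ¬ T b → ind b ≡ 0
ind-¬T {true}  ¬t = ⊥-elim (¬t tt)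
ind-¬T {false} _  = refl

length-filterᵇ : ∀ {A : Set} (p : A → Bool) xs → length (filterᵇ p xs) ≡ sum (map (ind ∘ p) xs)
length-filterᵇ p []       = refl
length-filterᵇ p (x ∷ xs) with p x
... | true  = cong suc (length-filterᵇ p xs)
... | false = length-filterᵇ p xs

sum-map-+ : ∀ {A : Set} (f g : A → ℕ) xs →
            sum (map (λ x → f x + g x) xs) ≡ sum (map f xs) + sum (map g xs)
sum-map-+ f g []       = refl
sum-map-+ f g (x ∷ xs) = trans (cong (f x + g x +_) (sum-map-+ f g xs)) (interchange (f x) (g x) _ _)

sum-map-0 : ∀ {A : Set} (f : A → ℕ) xs → (∀ {x} → x ∈ xs → f x ≡ 0) → sum (map f xs) ≡ 0
sum-map-0 f []       _   = refl
sum-map-0 f (x ∷ xs) f≡0 = cong₂ _+_ (f≡0 (here refl)) (sum-map-0 f xs (f≡0 ∘ there))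

sum-map-comm : ∀ {A B : Set} (f : A → B → ℕ) xs ys →
  sum (map (λ x → sum (map (f x) ys)) xs) ≡ sum (map (λ y → sum (map (λ x → f x y) xs)) ys)
sum-map-comm f []       ys = sym (sum-map-0 _ ys (λ _ → refl))
sum-map-comm f (x ∷ xs) ys = trans (cong (sum (map (f x) ys) +_) (sum-map-comm f xs ys))
                                   (sym (sum-map-+ (f x) (λ y → sum (map (λ x → f x y) xs)) ys))

sum-map-comm₂ : ∀ {A B C : Set} (f : A → B → C → ℕ) (xs : List A) (ys : A → List B) zs →
  sum (map (λ x → sum (map (λ y → sum (map (f x y) zs)) (ys x))) xs)
    ≡ sum (map (λ z → sum (map (λ x → sum (map (λ y → f x y z) (ys x))) xs)) zs)
sum-map-comm₂ f xs ys zs =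
  trans (cong sum (map-cong (λ x → sum-map-comm (f x) (ys x) zs) xs))
        (sum-map-comm (λ x z → sum (map (λ y → f x y z) (ys x))) xs zs)

sum-map-cong : ∀ {A : Set} {f g : A → ℕ} xs → (∀ {x} → x ∈ xs → f x ≡ g x) →
               sum (map f xs) ≡ sum (map g xs)
sum-map-cong xs f≡g = cong sum (map-cong-local (All.tabulate f≡g))

sum-map-1 : ∀ {A : Set} (xs : List A) → sum (map (λ _ → 1) xs) ≡ length xs
sum-map-1 []       = refl
sum-map-1 (x ∷ xs) = cong suc (sum-map-1 xs)

sum-map-δ : ∀ {A : Set} (f : A → ℕ) {xs v} → Unique xs → v ∈ xs →
            f v ≡ 1 → (∀ {x} → x ≢ v → f x ≡ 0) → sum (map f xs) ≡ 1
sum-map-δ f {x ∷ xs} (x∉xs AllPairs.∷ _)    (here refl) fv≡1 f≡0 =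
  cong₂ _+_ fv≡1 (sum-map-0 f xs λ y∈ → f≡0 λ { refl → All.lookup x∉xs y∈ refl })
sum-map-δ f {x ∷ xs} (x∉xs AllPairs.∷ uniq) (there v∈)  fv≡1 f≡0 =
  cong₂ _+_ (f≡0 λ { refl → All.lookup x∉xs v∈ refl }) (sum-map-δ f uniq v∈ fv≡1 f≡0)

∈-range⁺ : ∀ {a b q} → a ≤ q → q ≤ b → q ∈ range a b
∈-range⁺ {a} {b} a≤q q≤b =
  subst (_∈ range a b) (m+[n∸m]≡n a≤q) (∈-map⁺ (a +_) (∈-upTo⁺ (∸-monoˡ-< (s≤s q≤b) a≤q)))

range-unique : ∀ a b → Unique (range a b)
range-unique a b = Uniqueₚ.map⁺ (+-cancelˡ-≡ a _ _) (Uniqueₚ.upTo⁺ (suc b ∸ a))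

length-range : ∀ a b → length (range a b) ≡ suc b ∸ a
length-range a b = trans (length-map (a +_) (upTo (suc b ∸ a))) (length-upTo (suc b ∸ a))

∈-range⁻ : ∀ {a b q} → q ∈ range a b → a ≤ q × q ≤ b
∈-range⁻ {a} {b} q∈ with j , j∈ , refl ← ∈-map⁻ (a +_) q∈ = m≤m+n a j , a+j≤b
  where
  j< : j < suc b ∸ a
  j< = ∈-upTo⁻ j∈
  a≤1+b : a ≤ suc b
  a≤1+b = <⇒≤ (m∸n≢0⇒n<m λ eq → n≮0 (subst (j <_) eq j<))
  a+j≤b : a + j ≤ b
  a+j≤b with s≤s j+a≤b ← m≤o∸n⇒m+n≤o (suc j) a≤1+b j< = subst (_≤ b) (+-comm j a) j+a≤b

-- Every sequence is counted by exactly one summand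

weight : ℕ → ℕ → List ℕ → ℕ
weight m p σ = ind (uniqueMaxAt m p σ) + ind (doubleMaxAt m p σ)

length-filterᵇ-weight : ∀ m p σs →
  length (filterᵇ (uniqueMaxAt m p) σs) + length (filterᵇ (doubleMaxAt m p) σs) ≡ sum (map (weight m p) σs)
length-filterᵇ-weight m p σs =
  trans (cong₂ _+_ (length-filterᵇ (uniqueMaxAt m p) σs) (length-filterᵇ (doubleMaxAt m p) σs))
        (sym (sum-map-+ (ind ∘ uniqueMaxAt m p) (ind ∘ doubleMaxAt m p) σs))

uniqueMaxAt⇒countL : ∀ {m p} σ → T (uniqueMaxAt m p σ) → countL m σ ≡ 1
uniqueMaxAt⇒countL {m} σ t with _ , tcount , _ ← T-∧₃⁻ {maxL σ ≡ᵇ m} {countL m σ ≡ᵇ 1} t = ≡ᵇ⇒≡ _ 1 tcount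

doubleMaxAt⇒countL : ∀ {m p} σ → T (doubleMaxAt m p σ) → countL m σ ≡ 2
doubleMaxAt⇒countL {m} σ t with _ , tcount , _ ← T-∧₃⁻ {maxL σ ≡ᵇ m} {countL m σ ≡ᵇ 2} t = ≡ᵇ⇒≡ _ 2 tcount

uniqueMaxAt⇒key : ∀ {m p} σ → T (uniqueMaxAt m p σ) → maxL σ ≡ m × firstPos m σ ≡ p
uniqueMaxAt⇒key {m} σ t =
  maxL-≡ (subst (m ∈_) (sym split) (∈-++⁺ʳ u (here refl))) bounded ,
  trans (cong (firstPos m) split) (trans (firstPos-++ u r m∉u) position)
  where open UniqueMaxAt (uniqueMaxAt⁻ σ t)

doubleMaxAt⇒key : ∀ {m p} σ → T (doubleMaxAt m p σ) → maxL σ ≡ m × firstPos m σ ≡ p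
doubleMaxAt⇒key {m} σ t with tmax , _ , tpos ← T-∧₃⁻ {maxL σ ≡ᵇ m} {countL m σ ≡ᵇ 2} t =
  ≡ᵇ⇒≡ _ m tmax , ≡ᵇ⇒≡ _ _ tpos

weight-off : ∀ m p σ → ¬ (maxL σ ≡ m × firstPos m σ ≡ p) → weight m p σ ≡ 0
weight-off m p σ off = cong₂ _+_ (ind-¬T (off ∘ uniqueMaxAt⇒key σ)) (ind-¬T (off ∘ doubleMaxAt⇒key σ))

one-or-two : ∀ {n} → 1 ≤ n → n ≤ 2 → n ≡ 1 ⊎ n ≡ 2
one-or-two {1} _ _ = inj₁ refl
one-or-two {2} _ _ = inj₂ refl
one-or-two {suc (suc (suc _))} _ (s≤s (s≤s ()))

weight-on : ∀ σ → 1 ≤ countL (maxL σ) σ → countL (maxL σ) σ ≤ 2 →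
            weight (maxL σ) (firstPos (maxL σ) σ) σ ≡ 1
weight-on σ 1≤c c≤2 with one-or-two 1≤c c≤2
... | inj₁ c≡1 = cong₂ _+_ (ind-T (uniqueMaxAt⁺ unique))
                           (ind-¬T λ t → 1+n≢n (trans (sym (doubleMaxAt⇒countL σ t)) c≡1))
  where
  M = maxL σ
  unique : UniqueMaxAt M (firstPos M σ) σ
  unique with u , r , split , m∉u , c₀ ← countL-split M σ c≡1 = record
    { u = u ; r = r ; split = split ; position = sym (trans (cong (firstPos M) split) (firstPos-++ u r m∉u))
    ; m∉u = m∉u ; m∉r = countL≡0⇒∉ c₀ ; bounded = maxL-upper σ }
... | inj₂ c≡2 = cong₂ _+_ (ind-¬T λ t → 1+n≢n (trans (sym c≡2) (uniqueMaxAt⇒countL σ t)))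
                           (ind-T (T-∧₃⁺ (≡⇒≡ᵇ M M refl) (≡⇒≡ᵇ _ 2 c≡2)
                                         (≡⇒≡ᵇ (firstPos M σ) _ refl)))
  where
  M = maxL σ

firstPos-bounds : ∀ {m σ} → m ∈ σ → InvFrom 1 σ → m < firstPos m σ × firstPos m σ ≤ length σ
firstPos-bounds {m} {σ} m∈ inv
  with u , r , split , m∉u , _ ← countL-split m σ (sym (m+[n∸m]≡n (∈⇒1≤countL m∈))) =
  subst (m <_) (sym P≡) m<P , subst (_≤ length σ) (sym P≡) P≤
  where
  P≡ : firstPos m σ ≡ suc (length u)
  P≡ = trans (cong (firstPos m) split) (firstPos-++ u r m∉u)
  m<P : m < suc (length u)
  m<P = subst (m <_) (+-comm (length u) 1)
              (proj₁ (proj₂ (InvFrom-++⁻ 1 u (subst (InvFrom 1) split inv))))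
  P≤ : suc (length u) ≤ length σ
  P≤ = subst (suc (length u) ≤_) (sym (trans (cong length split) (trans (length-++ u) (+-suc _ _))))
             (s≤s (m≤m+n (length u) (length r)))

sum-weights : ∀ k {σ} → In𝓘 (suc k) σ →
  sum (map (λ m → sum (map (λ p → weight m p σ) (range (m + 1) (suc k)))) (range 0 k)) ≡ 1
sum-weights k {σ} σ∈ =
  sum-map-δ row (range-unique 0 k) (∈-range⁺ z≤n (s≤s⁻¹ (<-≤-trans M<P P≤))) row-M row-off
  where
  open In𝓘 σ∈
  M = maxL σ
  P = firstPos M σ
  row : ℕ → ℕ
  row m = sum (map (λ p → weight m p σ) (range (m + 1) (suc k)))
  M∈σ : M ∈ σ
  M∈σ = maxL-∈ σ (subst (0 <_) (sym size) (s≤s z≤n))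
  M<P : M < P
  M<P = proj₁ (firstPos-bounds M∈σ entries)
  P≤ : P ≤ suc k
  P≤ = subst (P ≤_) size (proj₂ (firstPos-bounds M∈σ entries))
  row-M : row M ≡ 1
  row-M = sum-map-δ (λ p → weight M p σ) (range-unique (M + 1) (suc k))
                    (∈-range⁺ (subst (_≤ P) (+-comm 1 M) M<P) P≤)
                    (weight-on σ (∈⇒1≤countL M∈σ) (proj₁ avoids M))
                    (λ p≢P → weight-off M _ σ (p≢P ∘ sym ∘ proj₂))
  row-off : ∀ {m} → m ≢ M → row m ≡ 0
  row-off {m} m≢M =
    sum-map-0 (λ p → weight m p σ) (range (m + 1) (suc k)) λ _ → weight-off m _ σ (m≢M ∘ sym ∘ proj₁)

-- Sequences with two copies of the maximum

insertAt : ∀ {A : Set} → ℕ → A → List A → List A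
insertAt i x xs = take i xs ++ x ∷ drop i xs

insertAt-++ : ∀ {A : Set} {x : A} xs {ys} → insertAt (length xs) x (xs ++ ys) ≡ xs ++ x ∷ ys
insertAt-++ []       = refl
insertAt-++ (y ∷ xs) = cong (y ∷_) (insertAt-++ xs)

splitAt-≤ : ∀ {A : Set} (xs : List A) {i} → i ≤ length xs →
            ∃₂ λ ys zs → xs ≡ ys ++ zs × length ys ≡ i
splitAt-≤ xs       {zero}  _        = [] , xs , refl , refl
splitAt-≤ (x ∷ xs) {suc i} (s≤s i≤) with ys , zs , refl , refl ← splitAt-≤ xs i≤ = x ∷ ys , zs , refl , refl

splitAfter : ∀ {A : Set} u (x : A) r {i} → length u < i → i ≤ length (u ++ x ∷ r) →
             ∃₂ λ v w → r ≡ v ++ w × length (u ++ x ∷ v) ≡ i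
splitAfter []      x r {suc i} (s≤s _)     (s≤s i≤)
  with v , w , eq , refl ← splitAt-≤ r i≤ = v , w , eq , refl
splitAfter (y ∷ u) x r {suc i} (s≤s |u|<i) (s≤s i≤)
  with v , w , eq , refl ← splitAfter u x r |u|<i i≤ = v , w , eq , refl

++-∷-injective : ∀ {m} u r u′ r′ → u ++ m ∷ r ≡ u′ ++ m ∷ r′ → countL m u ≡ countL m u′ →
                 u ≡ u′ × r ≡ r′
++-∷-injective     []      r []       r′ eq c = refl , ∷-injectiveʳ eq
++-∷-injective {m} []      r (x ∷ u′) r′ eq c
  with refl ← ∷-injectiveˡ eq with () ← trans c (countL-here m u′)
++-∷-injective {m} (x ∷ u) r []       r′ eq c
  with refl ← ∷-injectiveˡ eq with () ← trans (sym c) (countL-here m u)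
++-∷-injective {m} (x ∷ u) r (y ∷ u′) r′ eq c with refl ← ∷-injectiveˡ eq | x ≟ m
... | yes refl with refl , refl ← ++-∷-injective u r u′ r′ (∷-injectiveʳ eq)
                                   (suc-injective (trans (sym (countL-here m u)) (trans c (countL-here m u′))))
                 = refl , refl
... | no x≢m   with refl , refl ← ++-∷-injective u r u′ r′ (∷-injectiveʳ eq)
                                   (trans (sym (countL-there u x≢m)) (trans c (countL-there u′ x≢m)))
                 = refl , refl

Unique-map⁺-local : ∀ {A B : Set} (f : A → B) {xs} → (∀ {x y} → x ∈ xs → y ∈ xs → f x ≡ f y → x ≡ y) →
                    Unique xs → Unique (map f xs)
Unique-map⁺-local f {[]}     _   _                    = AllPairs.[]
Unique-map⁺-local f {x ∷ xs} inj (x∉xs AllPairs.∷ uniq) =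
  Allₚ.map⁺ (All.tabulate λ y∈ fx≡fy → All.lookup x∉xs y∈ (inj (here refl) (there y∈) fx≡fy))
  AllPairs.∷ Unique-map⁺-local f (λ x∈ y∈ → inj (there x∈) (there y∈)) uniq

length-cartesianProduct : ∀ {A B : Set} (xs : List A) (ys : List B) →
                          length (cartesianProduct xs ys) ≡ length xs * length ys
length-cartesianProduct []       ys = refl
length-cartesianProduct (x ∷ xs) ys =
  trans (length-++ (map (x ,_) ys)) (cong₂ _+_ (length-map (x ,_) ys) (length-cartesianProduct xs ys))

length-unique-≡ : ∀ {A : Set} {xs ys : List A} → Unique xs → Unique ys → (∀ {x} → x ∈ xs ⇔ x ∈ ys) →
                  length xs ≡ length ys
length-unique-≡ uxs uys xs⇔ys = ↭-length (∼bag⇒↭ (unique∧set⇒bag uxs uys xs⇔ys))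

module TwoCopies (m p k : ℕ) where

  Single : List (List ℕ)
  Single = filterᵇ (uniqueMaxAt m p) (I k patterns)

  Positions : List ℕ
  Positions = range (suc p) (suc k)

  Double : List (List ℕ)
  Double = filterᵇ (doubleMaxAt m p) (I (suc k) patterns)

  pairs : List (List ℕ × ℕ)
  pairs = cartesianProduct Single Positions

  -- the inserted m becomes the q-th entry (1-indexed)
  insertMax : List ℕ × ℕ → List ℕ
  insertMax (τ , q) = insertAt (pred q) m τ

  ∈-Single⁻ : ∀ {τ} → τ ∈ Single → In𝓘 k τ × UniqueMaxAt m p τ
  ∈-Single⁻ {τ} τ∈ with τ∈𝓘 , t ← ∈-filter⁻ (T? ∘ uniqueMaxAt m p) τ∈ =
    ∈-𝓘⁻ k τ∈𝓘 , uniqueMaxAt⁻ τ t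

  ∈-Single⁺ : ∀ {τ} → In𝓘 k τ → UniqueMaxAt m p τ → τ ∈ Single
  ∈-Single⁺ τ∈𝓘 um = ∈-filter⁺ (T? ∘ uniqueMaxAt m p) (∈-𝓘⁺ k τ∈𝓘) (uniqueMaxAt⁺ um)

  ∈-Double⁻ : ∀ {σ} → σ ∈ Double → In𝓘 (suc k) σ × DoubleMaxAt m p σ
  ∈-Double⁻ {σ} σ∈ with σ∈𝓘 , t ← ∈-filter⁻ (T? ∘ doubleMaxAt m p) σ∈ =
    ∈-𝓘⁻ (suc k) σ∈𝓘 , doubleMaxAt⁻ σ t

  ∈-Double⁺ : ∀ {σ} → In𝓘 (suc k) σ → DoubleMaxAt m p σ → σ ∈ Double
  ∈-Double⁺ σ∈𝓘 dm = ∈-filter⁺ (T? ∘ doubleMaxAt m p) (∈-𝓘⁺ (suc k) σ∈𝓘) (doubleMaxAt⁺ dm)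

  record InsertionView (τ : List ℕ) (q : ℕ) : Set where
    field
      u v w    : List ℕ
      split    : τ ≡ (u ++ m ∷ v) ++ w
      position : suc (length u) ≡ p
      q≡       : q ≡ suc (length (u ++ m ∷ v))
      m∉u      : m ∉ u
      m∉v      : m ∉ v
      m∉w      : m ∉ w

  view : ∀ {τ q} → In𝓘 k τ → UniqueMaxAt m p τ → suc p ≤ q → q ≤ suc k → InsertionView τ q
  view {q = suc i} τ∈𝓘 record { u = u ; r = r ; split = refl ; position = refl ; m∉u = m∉u ; m∉r = m∉r }
       (s≤s |u|<i) q≤
    with v , w , refl , |xs|≡i ← splitAfter u m r |u|<i (subst (i ≤_) (sym (In𝓘.size τ∈𝓘)) (s≤s⁻¹ q≤))
    = record
    { u = u ; v = v ; w = w ; split = sym (++-assoc u (m ∷ v) w) ; position = refl ; q≡ = cong suc (sym |xs|≡i)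
    ; m∉u = m∉u ; m∉v = m∉r ∘ ∈-++⁺ˡ ; m∉w = m∉r ∘ ∈-++⁺ʳ v }

  pair-view : ∀ {τ q} → (τ , q) ∈ pairs → InsertionView τ q
  pair-view τq∈ with τ∈ , q∈ ← ∈-cartesianProduct⁻ Single Positions τq∈
                with τ∈𝓘 , um ← ∈-Single⁻ τ∈ | p<q , q≤ ← ∈-range⁻ {suc p} {suc k} q∈ =
    view τ∈𝓘 um p<q q≤

  insertMax-view : ∀ {τ q} (V : InsertionView τ q) → let open InsertionView V in
                   insertMax (τ , q) ≡ (u ++ m ∷ v) ++ m ∷ w
  insertMax-view record { u = u ; v = v ; split = refl ; q≡ = refl } = insertAt-++ (u ++ m ∷ v)

  insertMax-injective : ∀ {x y} → x ∈ pairs → y ∈ pairs → insertMax x ≡ insertMax y → x ≡ y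
  insertMax-injective x∈ y∈ eq with pair-view x∈ | pair-view y∈
  ... | V@record { u = u ; v = v ; w = w ; split = refl ; q≡ = refl ; m∉u = m∉u ; m∉v = m∉v }
      | V′@record { u = u′ ; v = v′ ; w = w′ ; split = refl ; q≡ = refl ; m∉u = m∉u′ ; m∉v = m∉v′ }
    with xs≡ , w≡ ← ++-∷-injective (u ++ m ∷ v) w (u′ ++ m ∷ v′) w′
                      (trans (sym (insertMax-view V)) (trans eq (insertMax-view V′)))
                      (trans (countL-once u v m∉u m∉v) (sym (countL-once u′ v′ m∉u′ m∉v′))) =
    cong₂ (λ xs w → xs ++ w , suc (length xs)) xs≡ w≡

  image⊆Double : ∀ {σ} → σ ∈ map insertMax pairs → σ ∈ Double
  image⊆Double σ∈ with (τ , q) , τq∈ , refl ← ∈-map⁻ insertMax σ∈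
                  with τ∈ , _ ← ∈-cartesianProduct⁻ Single Positions τq∈
                  with τ∈𝓘 , um ← ∈-Single⁻ τ∈ = insertion τ∈𝓘 um (pair-view τq∈)
    where
    insertion : ∀ {τ q} → In𝓘 k τ → UniqueMaxAt m p τ → InsertionView τ q → insertMax (τ , q) ∈ Double
    insertion {τ} τ∈𝓘 um V@record { u = u ; v = v ; w = w ; split = refl ; position = position
                                    ; m∉u = m∉u ; m∉v = m∉v ; m∉w = m∉w } =
      subst (_∈ Double) (sym (insertMax-view V))
        (∈-Double⁺ (In𝓘-insert (u ++ m ∷ v) τ∈𝓘 (∈-++⁺ʳ u (here refl)) (≤-reflexive count≡1) bounded′)
                   record
          { u = u ; v = v ; w = w ; split = ++-assoc u (m ∷ v) (m ∷ w) ; position = position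
          ; m∉u = m∉u ; m∉v = m∉v ; m∉w = m∉w ; bounded = All-insert (u ++ m ∷ v) bounded′ ≤-refl })
      where
      count≡1 = uniqueMaxAt⇒countL τ (uniqueMaxAt⁺ um)
      bounded′ = UniqueMaxAt.bounded um

  Double⊆image : ∀ {σ} → σ ∈ Double → σ ∈ map insertMax pairs
  Double⊆image σ∈ with σ∈𝓘 , dm ← ∈-Double⁻ σ∈ = deletion σ∈𝓘 dm
    where
    deletion : ∀ {σ} → In𝓘 (suc k) σ → DoubleMaxAt m p σ → σ ∈ map insertMax pairs
    deletion σ∈𝓘 record { u = u ; v = v ; w = w ; split = refl ; position = refl
                        ; m∉u = m∉u ; m∉v = m∉v ; m∉w = m∉w ; bounded = bounded } =
      subst (_∈ map insertMax pairs) (trans (insertAt-++ xs) (sym σ≡))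
            (∈-map⁺ insertMax (∈-cartesianProduct⁺ τ∈ q∈))
      where
      xs = u ++ m ∷ v
      σ≡ : u ++ m ∷ v ++ m ∷ w ≡ xs ++ m ∷ w
      σ≡ = sym (++-assoc u (m ∷ v) (m ∷ w))
      bounded′ : All (_≤ m) (xs ++ m ∷ w)
      bounded′ = subst (All (_≤ m)) σ≡ bounded
      w<m : All (_< m) w
      w<m = All.tabulate λ y∈ →
              ≤∧≢⇒< (All.lookup bounded′ (∈-++⁺ʳ xs (there y∈))) λ { refl → m∉w y∈ }
      τ∈𝓘 : In𝓘 k (xs ++ w)
      τ∈𝓘 = In𝓘-delete xs (subst (In𝓘 (suc k)) σ≡ σ∈𝓘) w<m
      τ∈ : xs ++ w ∈ Single
      τ∈ = ∈-Single⁺ τ∈𝓘 record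
        { u = u ; r = v ++ w ; split = ++-assoc u (m ∷ v) w ; position = refl
        ; m∉u = m∉u ; m∉r = ∉-++ m∉v m∉w ; bounded = All-resp-⊆ (⊆-delete xs) bounded′ }
      q∈ : suc (length xs) ∈ Positions
      q∈ = ∈-range⁺ (s≤s (subst (suc (length u) ≤_) (sym (length-++-sucʳ u m v)) (s≤s (length-++-≤ˡ u))))
                    (s≤s (subst (length xs ≤_) (In𝓘.size τ∈𝓘) (length-++-≤ˡ xs)))

  length-Double : length Double ≡ (suc k ∸ p) * 𝔞 k m p
  length-Double = begin
    length Double
      ≡⟨ length-unique-≡ Double-unique image-unique (mk⇔ Double⊆image image⊆Double) ⟩
    length (map insertMax pairs)     ≡⟨ length-map insertMax pairs ⟩
    length pairs                     ≡⟨ length-cartesianProduct Single Positions ⟩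
    length Single * length Positions ≡⟨ cong (length Single *_) (length-range (suc p) (suc k)) ⟩
    𝔞 k m p * (suc k ∸ p)            ≡⟨ *-comm (𝔞 k m p) _ ⟩
    (suc k ∸ p) * 𝔞 k m p            ∎
    where
    open ≡-Reasoning
    Double-unique = Uniqueₚ.filter⁺ (T? ∘ doubleMaxAt m p) (𝓘-unique (suc k))
    image-unique = Unique-map⁺-local insertMax insertMax-injective
                     (Uniqueₚ.cartesianProduct⁺ (Uniqueₚ.filter⁺ (T? ∘ uniqueMaxAt m p) (𝓘-unique k))
                                                (range-unique (suc p) (suc k)))

theorem5 : ∀ (n : ℕ) → 2 ≤ n →
    length (I n (p000 ∷ p201 ∷ [])) ≡
      sum (map (λ m → sum (map (λ p → 𝔞 n m p + (n ∸ p) * 𝔞 (n ∸ 1) m p)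
                               (range (m + 1) n)))
               (range 0 (n ∸ 1)))
theorem5 (suc k) _ = begin
  length 𝓘
    ≡⟨ sum-map-1 𝓘 ⟨
  sum (map (λ _ → 1) 𝓘)
    ≡⟨ sum-map-cong 𝓘 (sum-weights k ∘ ∈-𝓘⁻ (suc k)) ⟨
  sum (map (λ σ → Σ[m,p] λ m p → weight m p σ) 𝓘)
    ≡⟨ sum-map-comm₂ weight (range 0 k) P 𝓘 ⟨
  Σ[m,p] (λ m p → sum (map (weight m p) 𝓘))
    ≡⟨ Σ[m,p]-cong (λ m p → length-filterᵇ-weight m p 𝓘) ⟨
  Σ[m,p] (λ m p → 𝔞 (suc k) m p + length (Double m p k))
    ≡⟨ Σ[m,p]-cong (λ m p → cong (𝔞 (suc k) m p +_) (length-Double m p k)) ⟩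
  Σ[m,p] (λ m p → 𝔞 (suc k) m p + (suc k ∸ p) * 𝔞 k m p) ∎
  where
  open ≡-Reasoning
  open TwoCopies using (Double; length-Double)
  𝓘 = I (suc k) patterns
  P : ℕ → List ℕ
  P m = range (m + 1) (suc k)
  Σ[m,p] : (ℕ → ℕ → ℕ) → ℕ
  Σ[m,p] f = sum (map (λ m → sum (map (f m) (P m))) (range 0 k))
  Σ[m,p]-cong : ∀ {f g} → (∀ m p → f m p ≡ g m p) → Σ[m,p] f ≡ Σ[m,p] g
  Σ[m,p]-cong f≡g = cong sum (map-cong (λ m → cong sum (map-cong (f≡g m) (P m))) (range 0 k))
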